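{- $DQ\Lambda\cong\mathrm{DQSym}$ as Hopf algebras.
   Context: Work over a field $\mathbb{K}$. $[\bar n,n]=\{\bar n,\dots,\bar1,1,\dots,n\}$, elements $\bar i$ negative, $i$ positive. A section is $s:[n]\to[\bar n,n]$ with $s(i)\in\{i,\bar i\}$. A set composition of a finite set $X$ is an ordered list $F_1|\cdots|F_k$ of nonempty disjoint subsets with union $X$; for $Y\subseteq X$, $F|_Y=F_1\cap Y|\cdots|F_k\cap Y$ with empty blocks deleted. For set compositions $F\models X$, $G\models Y$ with $X\cap Y=\emptyset$, a quasishuffle of $F$ and $G$ is a set composition $H$ of $X\cup Y$ with $H|_X=F$ and $H|_Y=G$ (equivalently: interleave the blocks of $F$ and $G$ preserving their orders, possibly merging adjacent pairs consisting of one block of $F$ and one block of $G$). The symmetric group $\mathcal{S}_n$ acts on $[\bar n,n]$ by $\pi(\bar i)=\overline{\pi(i)}$, hence on set compositions of images $s([n])$ of sections. $DQ\Lambda$ is the graded vector space $\widetilde{K^{\mathcal{H}}}\circ\mathcal{S}(\ell^{*}\circ\mathsf{e}_+)=\bigoplus_{n\ge0}\big(\bigoplus_{s}\bigoplus_{F\models s([n])}\mathbb{K}F\big)_{\mathcal{S}_n}$, i.e. its degree-$n$ part has basis the $\mathcal{S}_n$-orbits $[F]$ of set compositions $F$ of sets $s([n])$, $s$ a section. Its Hopf algebra structure (induced from the Hopf monoid $\ell^*\circ\mathsf{e}_+$, whose product is quasishuffle and coproduct deconcatenation, through the bilax functors $\mathcal{S}$ and $\widetilde{K^{\mathcal{H}}}$)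 is: for $[F]$ of degree $n$ and $[G]$ of degree $m$, $[F]\cdot[G]=\sum_H[H]$ over all quasishuffles $H$ of $F$ and $G'$, where $G'$ is obtained from $G$ by replacing each $i$ by $n+i$ and each $\bar i$ by $\overline{n+i}$; and $\Delta[F_1|\cdots|F_k]=\sum_{i=0}^k[\mathrm{st}(F_1|\cdots|F_i)]\otimes[\mathrm{st}(F_{i+1}|\cdots|F_k)]$, where $\mathrm{st}$ relabels the underlying elements by the unique bijection to some $[\bar j,j]$ that preserves the order of absolute values and the signs; the unit is the empty composition in degree $0$. $\mathrm{DQSym}$ is the Hopf algebra with basis $\{M_c\}$ indexed by bicompositions $c$ (finite lists of columns $\binom{\alpha_i}{\beta_i}$ of nonnegative integers, each $\ne\binom00$; degree $\sum(\alpha_i+\beta_i)$, including the empty bicomposition), with product $M_aM_b=\sum_c M_c$ over all quasishuffles $c$ of $a$ and $b$ (interleavings of the columns of $a$ and $b$ preserving their orders, in which some adjacent pairs consisting of one column from $a$ and one from $b$ may be replaced by their sum $\binom{\alpha+\alpha'}{\beta+\beta'}$), and coproduct by deconcatenation $\Delta M_{c_1\cdots c_k}=\sum_{i=0}^kM_{c_1\cdots c_i}\otimes M_{c_{i+1}\cdots c_k}$. -}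

module Defs where

open import Level using (Level; _⊔_; suc)
open import Algebra.Bundles using (CommutativeRing)
open import Data.Bool using (Bool; true; false; T; _∧_; _∨_; not; if_then_else_)
open import Data.Bool.Properties using (T?)
open import Data.Nat as ℕ using (ℕ; zero) renaming (suc to sucℕ)
open import Data.Fin using (Fin)
open import Data.Fin.Permutation using (Permutation′; _⟨$⟩ˡ_)
open import Data.Vec as Vec using (Vec; []; _∷_; _++_; replicate; tabulate; lookup)
open import Data.List as List using (List; []; _∷_; map; concat; concatMap; foldr; [_])
open import Data.Product using (Σ; _×_; _,_; proj₁; proj₂; ∃)
open import Data.Empty using (⊥)
open import Relation.Nullary using (¬_; yes; no)

record Field (c ℓ : Level) : Set (suc (c ⊔ ℓ)) where
  field
    commRing : CommutativeRing c ℓ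
  open CommutativeRing commRing public
  field
    0≉1 : ¬ (0# ≈ 1#)
    inverse : ∀ x → ¬ (x ≈ 0#) → ∃ λ y → (x * y) ≈ 1#

qsh : ∀ {a} {A : Set a} → (A → A → A) → List A → List A → List (List A)
qsh _⊕_ [] ys = [ ys ]
qsh _⊕_ (x ∷ xs) [] = [ x ∷ xs ]
qsh _⊕_ (x ∷ xs) (y ∷ ys) =
  map (x ∷_) (qsh _⊕_ xs (y ∷ ys))
  List.++ map (y ∷_) (qsh _⊕_ (x ∷ xs) ys)
  List.++ map ((x ⊕ y) ∷_) (qsh _⊕_ xs ys)

splits : ∀ {a} {A : Set a} → List A → List (List A × List A)
splits [] = [ ([] , []) ]
splits (x ∷ xs) = ([] , x ∷ xs) ∷ map (λ p → (x ∷ proj₁ p , proj₂ p)) (splits xs)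

-- a Hopf algebra (bialgebra data) given on a basis B modulo a relation R,
-- with all structure constants in {0,1} as in the paper
record BasisBialg : Set₁ where
  field
    Basis : Set
    Rel   : Basis → Basis → Set
    unitB : Basis
    prodB : Basis → Basis → List Basis
    copB  : Basis → List (Basis × Basis)
    counitB : Basis → Bool


-- Free modules modulo a relation on the basis:  K^(B) / span { b - b' | R b b' }
-- Vectors are represented by finite formal sums  List (K × B).

module FreeMod {c ℓ : Level} (K : Field c ℓ) where
  open Field K

  Vect : Set → Set c
  Vect B = List (Carrier × B)

  data Equiv {B : Set} (R : B → B → Set) : Vect B → Vect B → Set (c ⊔ ℓ) where
    ∼-refl  : ∀ {v} → Equiv R v v
    ∼-sym   : ∀ {v w} → Equiv R v w → Equiv R w v
    ∼-trans : ∀ {u v w} → Equiv R u v → Equiv R v w → Equiv R u w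
    ∼-cons  : ∀ {t v w} → Equiv R v w → Equiv R (t ∷ v) (t ∷ w)
    ∼-swap  : ∀ {t t' v} → Equiv R (t ∷ t' ∷ v) (t' ∷ t ∷ v)
    ∼-zero  : ∀ {b v} → Equiv R ((0# , b) ∷ v) v
    ∼-add   : ∀ {a a' b v} → Equiv R ((a , b) ∷ (a' , b) ∷ v) ((a + a' , b) ∷ v)
    ∼-coef  : ∀ {a a' b v} → a ≈ a' → Equiv R ((a , b) ∷ v) ((a' , b) ∷ v)
    ∼-rel   : ∀ {a b b' v} → R b b' → Equiv R ((a , b) ∷ v) ((a , b') ∷ v)

  scale : ∀ {B} → Carrier → Vect B → Vect B
  scale a = map (λ t → (a * proj₁ t , proj₂ t))

  basisSum : ∀ {B} → List B → Vect B
  basisSum = map (λ b → (1# , b))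

  tensorV : ∀ {B C} → Vect B → Vect C → Vect (B × C)
  tensorV v w = concatMap (λ t → map (λ u → (proj₁ t * proj₁ u , (proj₂ t , proj₂ u))) w) v

  -- relation on B × C whose quotient is the tensor product of the quotients
  data TRel {B C : Set} (R : B → B → Set) (S : C → C → Set) : B × C → B × C → Set where
    left  : ∀ {b b' x} → R b b' → TRel R S (b , x) (b' , x)
    right : ∀ {b x x'} → S x x' → TRel R S (b , x) (b , x')

  module Ops (H : BasisBialg) where
    open BasisBialg H
    V = Vect Basis
    _≋_ : V → V → Set (c ⊔ ℓ)
    v ≋ w = Equiv Rel v w
    _≋⊗_ : Vect (Basis × Basis) → Vect (Basis × Basis) → Set (c ⊔ ℓ)
    v ≋⊗ w = Equiv (TRel Rel Rel) v w
    one : V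
    one = [ (1# , unitB) ]
    mul : V → V → V
    mul v w = concatMap (λ t → concatMap (λ u →
                 scale (proj₁ t * proj₁ u) (basisSum (prodB (proj₂ t) (proj₂ u)))) w) v
    Δ : V → Vect (Basis × Basis)
    Δ v = concatMap (λ t → scale (proj₁ t) (basisSum (copB (proj₂ t)))) v
    ε : V → Carrier
    ε v = foldr (λ t s → (proj₁ t * (if counitB (proj₂ t) then 1# else 0#)) + s) 0# v

  -- isomorphism of Hopf algebras (= bijective bialgebra morphism; the antipode
  -- is then automatically preserved)
  record HopfIso (A B : BasisBialg) : Set (c ⊔ ℓ) where
    private
      module A = Ops A
      module B = Ops B
    field
      φ : A.V → B.V
      φ-cong   : ∀ {v w} → v A.≋ w → φ v B.≋ φ w
      φ-add    : ∀ v w → φ (v List.++ w) B.≋ (φ v List.++ φ w)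
      φ-scale  : ∀ a v → φ (scale a v) B.≋ scale a (φ v)
      φ-inj    : ∀ {v w} → φ v B.≋ φ w → v A.≋ w
      φ-surj   : ∀ y → ∃ λ x → φ x B.≋ y
      φ-one    : φ A.one B.≋ B.one
      φ-mul    : ∀ v w → φ (A.mul v w) B.≋ B.mul (φ v) (φ w)
      φ-Δ      : ∀ v → B.Δ (φ v) B.≋⊗
                   concatMap (λ t → scale (proj₁ t)
                     (tensorV (φ [ (1# , proj₁ (proj₂ t)) ]) (φ [ (1# , proj₂ (proj₂ t)) ]))) (A.Δ v)
      φ-ε      : ∀ v → B.ε (φ v) ≈ A.ε v

  _≅Hopf_ : BasisBialg → BasisBialg → Set (c ⊔ ℓ)
  A ≅Hopf B = HopfIso A B

-- DQΛ
-- A set composition F of s([n]) (s a section) is encoded by the section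
-- s : Vec Bool n  (true at i  means  s(i) = ī)  together with the ordered list
-- of blocks, each block given by the set of indices i with s(i) in it.

Subset : ℕ → Set
Subset n = Vec Bool n

record RawComp (n : ℕ) : Set where
  constructor comp
  field
    sect   : Vec Bool n
    blocks : List (Subset n)

anyV : ∀ {n} → Vec Bool n → Bool
anyV [] = false
anyV (x ∷ v) = x ∨ anyV v

allV : ∀ {n} → Vec Bool n → Bool
allV [] = true
allV (x ∷ v) = x ∧ allV v

allL : List Bool → Bool
allL = foldr _∧_ true

exactlyOne : List Bool → Bool
exactlyOne [] = false
exactlyOne (true ∷ xs) = allL (map not xs)
exactlyOne (false ∷ xs) = exactlyOne xs

validComp : ∀ {n} → RawComp n → Bool
validComp {n} (comp s bs) =
  allL (map anyV bs) ∧ allV (tabulate (λ i → exactlyOne (map (λ b → lookup b i) bs)))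

Comp : Set
Comp = Σ ℕ λ n → Σ (RawComp n) λ F → T (validComp F)

mkComp : ∀ {n} → RawComp n → List Comp
mkComp {n} F with T? (validComp F)
... | yes p = [ (n , F , p) ]
... | no _ = []

permV : ∀ {A : Set} {n} → Permutation′ n → Vec A n → Vec A n
permV π v = tabulate (λ j → lookup v (π ⟨$⟩ˡ j))

-- action of π ∈ S_n:  π(i) = π i,  π(ī) = (π i)‾
act : ∀ {n} → Permutation′ n → RawComp n → RawComp n
act π (comp s bs) = comp (permV π s) (map (permV π) bs)

data Orbit : Comp → Comp → Set where
  orb : ∀ {n} (π : Permutation′ n) (F : RawComp n) p q → Orbit (n , F , p) (n , act π F , q)

_∪_ : ∀ {n} → Subset n → Subset n → Subset n
_∪_ = Vec.zipWith _∨_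

prodComp : Comp → Comp → List Comp
prodComp (n , comp s bs , _) (m , comp t cs , _) =
  concatMap (λ H → mkComp (comp (s ++ t) H))
    (qsh _∪_ (map (λ b → b ++ replicate m false) bs)
             (map (λ c → replicate n false ++ c) cs))

count : ∀ {n} → Vec Bool n → ℕ
count [] = 0
count (true ∷ u) = sucℕ (count u)
count (false ∷ u) = count u

compress : ∀ {A : Set} {n} → Vec A n → (u : Vec Bool n) → Vec A (count u)
compress [] [] = []
compress (x ∷ v) (true ∷ u) = x ∷ compress v u
compress (x ∷ v) (false ∷ u) = compress v u

-- st of a list of blocks: restrict to their union and relabel order-preservingly
st : ∀ {n} → Vec Bool n → List (Subset n) → List Comp
st {n} s bs = mkComp (comp (compress s U) (map (λ b → compress b U) bs))
  where U = foldr _∪_ (replicate n false) bs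

copComp : Comp → List (Comp × Comp)
copComp (n , comp s bs , _) =
  concatMap (λ p → concatMap (λ x → map (λ y → (x , y)) (st s (proj₂ p))) (st s (proj₁ p)))
    (splits bs)

unitComp : Comp
unitComp = (0 , comp [] [] , _)

counitComp : Comp → Bool
counitComp (zero , _) = true
counitComp (sucℕ _ , _) = false

DQΛ : BasisBialg
DQΛ = record
  { Basis = Comp ; Rel = Orbit ; unitB = unitComp ; prodB = prodComp
  ; copB = copComp ; counitB = counitComp }

-- DQSym: basis M_c, c a bicomposition (columns (α , β) ≠ (0 , 0))

nonzeroCol : ℕ × ℕ → Bool
nonzeroCol (zero , zero) = false
nonzeroCol _ = true

BiComp : Set
BiComp = Σ (List (ℕ × ℕ)) λ c → T (allL (map nonzeroCol c))

mkBi : List (ℕ × ℕ) → List BiComp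
mkBi c with T? (allL (map nonzeroCol c))
... | yes p = [ (c , p) ]
... | no _ = []

addCol : ℕ × ℕ → ℕ × ℕ → ℕ × ℕ
addCol (a , b) (a' , b') = (a ℕ.+ a' , b ℕ.+ b')

prodBi : BiComp → BiComp → List BiComp
prodBi (a , _) (b , _) = concatMap mkBi (qsh addCol a b)

copBi : BiComp → List (BiComp × BiComp)
copBi (c , _) = concatMap (λ p → concatMap (λ x → map (λ y → (x , y)) (mkBi (proj₂ p))) (mkBi (proj₁ p))) (splits c)

counitBi : BiComp → Bool
counitBi ([] , _) = true
counitBi (_ ∷ _ , _) = false

noRel : BiComp → BiComp → Set
noRel _ _ = ⊥

DQSym : BasisBialg
DQSym = record
  { Basis = BiComp ; Rel = noRel ; unitB = ([] , _) ; prodB = prodBi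
  ; copB = copBi ; counitB = counitBi }

-- Send the orbit of a set composition F₁|⋯|Fₖ to M_c, where the i-th column of c
-- counts the positive and the negative elements of Fᵢ. This is constant on orbits,
-- turns quasishuffles of compositions into quasishuffles of bicompositions (merging
-- two disjoint blocks adds their columns), and commutes with deconcatenation since
-- standardization keeps the signs. It is a bijection on bases: every bicomposition
-- has a canonical preimage, and a composition is determined up to 𝔖ₙ by the multiset
-- of pairs (sign of an element, blocks containing it), which its columns determine.
-- All structure constants being 0 or 1, the bijection of bases is a Hopf isomorphism.
module Submission where

open import Defs
open import Level using (Level)
open import Data.Bool using (Bool; true; false; T; _∧_; _∨_; not; if_then_else_)
open import Data.Bool.Properties using (T?; T-irrelevant; T-∧; ∨-identityʳ)
open import Data.Nat as ℕ using (ℕ; zero; suc; _+_)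
import Data.Nat.Properties as ℕₚ
open import Data.Fin using (Fin; zero; suc)
open import Data.Fin.Permutation using (Permutation′; _⟨$⟩ˡ_; flip; lift₀; transpose; _∘ₚ_)
import Data.Fin.Permutation as Perm
open import Data.Vec as V using (Vec; []; _∷_; tabulate; lookup; replicate)
import Data.Vec.Properties as Vₚ
open import Data.Vec.Relation.Unary.All as VAll using ([]; _∷_) renaming (All to AllV)
import Data.Vec.Relation.Unary.All.Properties as VAllₚ
open import Data.List as L using (List; []; _∷_; [_]; concatMap)
import Data.List.Properties as Lₚ
open import Data.List.Relation.Unary.All as All using (All; []; _∷_)
import Data.List.Relation.Unary.All.Properties as Allₚ
open import Data.List.Relation.Binary.Permutation.Propositional as ↭ using (_↭_; prep; swap; ↭-sym; ↭-trans; ↭-refl; ↭-reflexive)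
import Data.List.Relation.Binary.Permutation.Propositional.Properties as ↭ₚ
open import Data.Vec.Relation.Binary.Pointwise.Inductive using (Pointwise; []; _∷_)
open import Data.Product using (Σ; _×_; _,_; proj₁; proj₂; ∃)
open import Data.Empty using (⊥-elim)
open import Data.Unit using (tt)
open import Function using (_∘_; _⇔_; mk⇔; Equivalence)
open import Relation.Nullary using (yes; no)
open import Relation.Binary.PropositionalEquality hiding ([_])

private
  variable
    n m : ℕ

-- Occurrence counts saturated at two

data Occ : Set where
  none once many : Occ

infixr 6 _⊕_
_⊕_ : Occ → Occ → Occ
none ⊕ y    = y
once ⊕ none = once
once ⊕ _    = many
many ⊕ _    = many

⊕-identityʳ : ∀ x → x ⊕ none ≡ x
⊕-identityʳ none = refl
⊕-identityʳ once = refl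
⊕-identityʳ many = refl

⊕-assoc : ∀ x y z → (x ⊕ y) ⊕ z ≡ x ⊕ (y ⊕ z)
⊕-assoc none y    z    = refl
⊕-assoc once none z    = refl
⊕-assoc once once none = refl
⊕-assoc once once once = refl
⊕-assoc once once many = refl
⊕-assoc once many z    = refl
⊕-assoc many y    z    = refl

⊕-comm : ∀ x y → x ⊕ y ≡ y ⊕ x
⊕-comm none none = refl
⊕-comm none once = refl
⊕-comm none many = refl
⊕-comm once none = refl
⊕-comm once once = refl
⊕-comm once many = refl
⊕-comm many none = refl
⊕-comm many once = refl
⊕-comm many many = refl

occ : Bool → Occ
occ false = none
occ true  = once

occurs : Occ → Bool
occurs none = false
occurs _    = true

isOnce : Occ → Bool
isOnce once = true
isOnce _    = false

tally : List Bool → Occ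
tally = L.foldr (λ x t → occ x ⊕ t) none

occurrences : List (Vec Bool n) → Vec Occ n
occurrences []       = replicate _ none
occurrences (b ∷ bs) = V.zipWith _⊕_ (V.map occ b) (occurrences bs)

occurrences-++ : (P S : List (Vec Bool n)) →
  occurrences (P L.++ S) ≡ V.zipWith _⊕_ (occurrences P) (occurrences S)
occurrences-++ []      S = sym (Vₚ.zipWith-identityˡ {f = _⊕_} (λ _ → refl) (occurrences S))
occurrences-++ (b ∷ P) S = begin
  V.zipWith _⊕_ (V.map occ b) (occurrences (P L.++ S))
    ≡⟨ cong (V.zipWith _⊕_ (V.map occ b)) (occurrences-++ P S) ⟩
  V.zipWith _⊕_ (V.map occ b) (V.zipWith _⊕_ (occurrences P) (occurrences S))
    ≡⟨ Vₚ.zipWith-assoc {f = _⊕_} ⊕-assoc (V.map occ b) _ _ ⟨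
  V.zipWith _⊕_ (occurrences (b ∷ P)) (occurrences S) ∎
  where open ≡-Reasoning

⊕-leftComm : ∀ x y z → x ⊕ (y ⊕ z) ≡ y ⊕ (x ⊕ z)
⊕-leftComm x y z = begin
  x ⊕ (y ⊕ z) ≡⟨ ⊕-assoc x y z ⟨
  (x ⊕ y) ⊕ z ≡⟨ cong (_⊕ z) (⊕-comm x y) ⟩
  (y ⊕ x) ⊕ z ≡⟨ ⊕-assoc y x z ⟩
  y ⊕ (x ⊕ z) ∎
  where open ≡-Reasoning

occurrences-↭ : {P S : List (Vec Bool n)} → P ↭ S → occurrences P ≡ occurrences S
occurrences-↭ ↭.refl          = refl
occurrences-↭ (prep b p)      = cong (V.zipWith _⊕_ (V.map occ b)) (occurrences-↭ p)
occurrences-↭ (swap a b p)    =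
  trans (leftComm (V.map occ a) (V.map occ b) _) (cong (λ X → V.zipWith _⊕_ (V.map occ b) (V.zipWith _⊕_ (V.map occ a) X)) (occurrences-↭ p))
  where
  leftComm : ∀ {n} (A B X : Vec Occ n) → V.zipWith _⊕_ A (V.zipWith _⊕_ B X) ≡ V.zipWith _⊕_ B (V.zipWith _⊕_ A X)
  leftComm []      []      []      = refl
  leftComm (a ∷ A) (b ∷ B) (x ∷ X) = cong₂ _∷_ (⊕-leftComm a b x) (leftComm A B X)
occurrences-↭ (↭.trans p q)   = trans (occurrences-↭ p) (occurrences-↭ q)

exactlyOne≡isOnce∘tally : ∀ xs → exactlyOne xs ≡ isOnce (tally xs)
exactlyOne≡isOnce∘tally []           = refl
exactlyOne≡isOnce∘tally (false ∷ xs) = exactlyOne≡isOnce∘tally xs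
exactlyOne≡isOnce∘tally (true ∷ xs)  = noneOthers xs
  where
  noneOthers : ∀ xs → allL (L.map not xs) ≡ isOnce (once ⊕ tally xs)
  noneOthers []           = refl
  noneOthers (true ∷ xs)  with tally xs
  ... | none = refl
  ... | once = refl
  ... | many = refl
  noneOthers (false ∷ xs) = noneOthers xs

lookup-occurrences : (bs : List (Vec Bool n)) (i : Fin n) →
  lookup (occurrences bs) i ≡ tally (L.map (λ b → lookup b i) bs)
lookup-occurrences []       i = Vₚ.lookup-replicate i none
lookup-occurrences (b ∷ bs) i = begin
  lookup (V.zipWith _⊕_ (V.map occ b) (occurrences bs)) i
    ≡⟨ Vₚ.lookup-zipWith _⊕_ i (V.map occ b) _ ⟩
  lookup (V.map occ b) i ⊕ lookup (occurrences bs) i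
    ≡⟨ cong₂ _⊕_ (Vₚ.lookup-map i occ b) (lookup-occurrences bs i) ⟩
  occ (lookup b i) ⊕ tally (L.map (λ b → lookup b i) bs) ∎
  where open ≡-Reasoning

NonemptyBlock : Vec Bool n → Set
NonemptyBlock b = T (anyV b)

ExactCover : List (Vec Bool n) → Set
ExactCover bs = AllV (_≡ once) (occurrences bs)

T-allV-isOnce : (X : Vec Occ n) → T (allV (V.map isOnce X)) ⇔ AllV (_≡ once) X
T-allV-isOnce []       = mk⇔ (λ _ → []) (λ _ → tt)
T-allV-isOnce (none ∷ X) = mk⇔ (λ ()) (λ { (() ∷ _) })
T-allV-isOnce (many ∷ X) = mk⇔ (λ ()) (λ { (() ∷ _) })
T-allV-isOnce (once ∷ X) = mk⇔ (λ h → refl ∷ Equivalence.to (T-allV-isOnce X) h)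
                               (λ { (_ ∷ h) → Equivalence.from (T-allV-isOnce X) h })

validComp≡ : (s : Vec Bool n) (bs : List (Vec Bool n)) →
  validComp (comp s bs) ≡ allL (L.map anyV bs) ∧ allV (V.map isOnce (occurrences bs))
validComp≡ s bs = cong (λ v → allL (L.map anyV bs) ∧ allV v) (begin
  tabulate (λ i → exactlyOne (L.map (λ b → lookup b i) bs))
    ≡⟨ Vₚ.tabulate-cong (λ i → trans (exactlyOne≡isOnce∘tally (L.map (λ b → lookup b i) bs)) (cong isOnce (sym (lookup-occurrences bs i)))) ⟩
  tabulate (λ i → isOnce (lookup (occurrences bs) i))
    ≡⟨ Vₚ.tabulate-cong (λ i → sym (Vₚ.lookup-map i isOnce (occurrences bs))) ⟩
  tabulate (lookup (V.map isOnce (occurrences bs)))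
    ≡⟨ Vₚ.tabulate∘lookup _ ⟩
  V.map isOnce (occurrences bs) ∎)
  where open ≡-Reasoning

validComp⇔ : (s : Vec Bool n) (bs : List (Vec Bool n)) →
  T (validComp (comp s bs)) ⇔ (All NonemptyBlock bs × ExactCover bs)
validComp⇔ s bs = mk⇔
  (λ v → let (ne , ex) = Equivalence.to T-∧ (subst T (validComp≡ s bs) v)
         in Allₚ.all⁺ anyV bs ne , Equivalence.to (T-allV-isOnce (occurrences bs)) ex)
  (λ (ne , ex) → subst T (sym (validComp≡ s bs))
    (Equivalence.from T-∧ (Allₚ.all⁻ anyV ne , Equivalence.from (T-allV-isOnce (occurrences bs)) ex)))

-- The column (α , β) of a block: its numbers of positive and of negative elements

signedHit : Bool → Bool → Bool → ℕ
signedHit τ     σ     false = 0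
signedHit false false true  = 1
signedHit false true  true  = 0
signedHit true  false true  = 0
signedHit true  true  true  = 1

countSign : Bool → Vec Bool n → Vec Bool n → ℕ
countSign τ []      []      = 0
countSign τ (σ ∷ s) (β ∷ b) = signedHit τ σ β + countSign τ s b

column : Vec Bool n → Vec Bool n → ℕ × ℕ
column s b = (countSign false s b , countSign true s b)

column-++ : (s x : Vec Bool n) (t y : Vec Bool m) →
  column (s V.++ t) (x V.++ y) ≡ addCol (column s x) (column t y)
column-++ s x t y = cong₂ _,_ (countSign-++ false s x) (countSign-++ true s x)
  where
  countSign-++ : ∀ τ (s x : Vec Bool n) → countSign τ (s V.++ t) (x V.++ y) ≡ countSign τ s x + countSign τ t y
  countSign-++ τ []      []      = refl
  countSign-++ τ (σ ∷ s) (β ∷ x) =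
    trans (cong (signedHit τ σ β +_) (countSign-++ τ s x)) (sym (ℕₚ.+-assoc (signedHit τ σ β) _ _))

column-empty : (s : Vec Bool n) → column s (replicate n false) ≡ (0 , 0)
column-empty []      = refl
column-empty (σ ∷ s) = column-empty s

column-padʳ : (s : Vec Bool n) (t : Vec Bool m) (b : Vec Bool n) →
  column (s V.++ t) (b V.++ replicate m false) ≡ column s b
column-padʳ s t b = begin
  column (s V.++ t) (b V.++ replicate _ false) ≡⟨ column-++ s b t _ ⟩
  addCol (column s b) (column t (replicate _ false)) ≡⟨ cong (addCol (column s b)) (column-empty t) ⟩
  addCol (column s b) (0 , 0) ≡⟨ cong₂ _,_ (ℕₚ.+-identityʳ _) (ℕₚ.+-identityʳ _) ⟩
  column s b ∎
  where open ≡-Reasoning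

column-padˡ : (s : Vec Bool n) (t : Vec Bool m) (c : Vec Bool m) →
  column (s V.++ t) (replicate n false V.++ c) ≡ column t c
column-padˡ s t c = trans (column-++ s _ t c) (cong (λ z → addCol z (column t c)) (column-empty s))

column-nonzero : (s b : Vec Bool n) → NonemptyBlock b → T (nonzeroCol (column s b))
column-nonzero (σ     ∷ s) (false ∷ b) h = column-nonzero s b h
column-nonzero (false ∷ s) (true  ∷ b) h = tt
column-nonzero (true  ∷ s) (true  ∷ b) h with countSign false s b
... | zero  = tt
... | suc _ = tt

column-permute : (π : Permutation′ n) (s b : Vec Bool n) → column (permV π s) (permV π b) ≡ column s b
column-permute {n} π s b = cong₂ _,_ (countSign-permute false) (countSign-permute true)
  where
  open import Algebra.Properties.CommutativeMonoid.Sum ℕₚ.+-0-commutativeMonoid using (sum; sum-permute; sum-cong-≗)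
  countSign≡sum : ∀ {n} τ (s b : Vec Bool n) → countSign τ s b ≡ sum (λ i → signedHit τ (lookup s i) (lookup b i))
  countSign≡sum τ []      []      = refl
  countSign≡sum τ (σ ∷ s) (β ∷ b) = cong (signedHit τ σ β +_) (countSign≡sum τ s b)
  countSign-permute : ∀ τ → countSign τ (permV π s) (permV π b) ≡ countSign τ s b
  countSign-permute τ = begin
    countSign τ (permV π s) (permV π b)
      ≡⟨ countSign≡sum τ (permV π s) (permV π b) ⟩
    sum (λ i → signedHit τ (lookup (permV π s) i) (lookup (permV π b) i))
      ≡⟨ sum-cong-≗ {n} (λ i → cong₂ (signedHit τ) (Vₚ.lookup∘tabulate _ i) (Vₚ.lookup∘tabulate _ i)) ⟩
    sum (λ i → signedHit τ (lookup s (π ⟨$⟩ˡ i)) (lookup b (π ⟨$⟩ˡ i)))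
      ≡⟨ sum-permute (λ i → signedHit τ (lookup s i) (lookup b i)) (flip π) ⟨
    sum (λ i → signedHit τ (lookup s i) (lookup b i))
      ≡⟨ countSign≡sum τ s b ⟨
    countSign τ s b ∎
    where open ≡-Reasoning

columns-nonzero : (s : Vec Bool n) (bs : List (Vec Bool n)) →
  All NonemptyBlock bs → T (allL (L.map nonzeroCol (L.map (column s) bs)))
columns-nonzero s bs ne = Allₚ.all⁻ nonzeroCol (Allₚ.map⁺ (All.map (λ {b} → column-nonzero s b) ne))

columnsOf : Comp → BiComp
columnsOf (n , comp s bs , v) =
  (L.map (column s) bs , columns-nonzero s bs (proj₁ (Equivalence.to (validComp⇔ s bs) v)))

BiComp-≡ : {c c' : List (ℕ × ℕ)} {p : T (allL (L.map nonzeroCol c))} {q : T (allL (L.map nonzeroCol c'))} →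
  c ≡ c' → _≡_ {A = BiComp} (c , p) (c' , q)
BiComp-≡ {c} {p = p} {q} refl = cong (c ,_) (T-irrelevant p q)

mkBi-valid : ∀ c (p : T (allL (L.map nonzeroCol c))) → mkBi c ≡ [ (c , p) ]
mkBi-valid c p with T? (allL (L.map nonzeroCol c))
... | yes _ = cong [_] (BiComp-≡ refl)
... | no ¬p = ⊥-elim (¬p p)

mkComp-valid : (F : RawComp n) (p : T (validComp F)) → mkComp F ≡ [ (n , F , p) ]
mkComp-valid F p with T? (validComp F)
... | yes p' = cong (λ z → [ (_ , F , z) ]) (T-irrelevant p' p)
... | no ¬p  = ⊥-elim (¬p p)

module _ {A B : Set} where

  map-map-∷ : (f : A → B) (x : A) {Q : List (List A)} {R : List (List B)} →
    L.map (L.map f) Q ≡ R → L.map (L.map f) (L.map (x ∷_) Q) ≡ L.map (f x ∷_) R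
  map-map-∷ f x {Q} refl = trans (sym (Lₚ.map-∘ Q)) (Lₚ.map-∘ Q)

  qsh-map : (f : A → B) {_⊕ᴬ_ : A → A → A} {_⊕ᴮ_ : B → B → B} {P Q : A → Set} →
    (∀ {x y} → P x → Q y → f (x ⊕ᴬ y) ≡ f x ⊕ᴮ f y) →
    ∀ {xs ys} → All P xs → All Q ys →
    L.map (L.map f) (qsh _⊕ᴬ_ xs ys) ≡ qsh _⊕ᴮ_ (L.map f xs) (L.map f ys)
  qsh-map f hom {[]}     {ys}     _          _          = refl
  qsh-map f hom {x ∷ xs} {[]}     _          _          = refl
  qsh-map f {_⊕ᴬ_} {_⊕ᴮ_} hom {x ∷ xs} {y ∷ ys} (px ∷ pxs) (py ∷ pys) = begin
    L.map (L.map f) (L.map (x ∷_) L₁ L.++ L.map (y ∷_) L₂ L.++ L.map ((x ⊕ᴬ y) ∷_) L₃)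
      ≡⟨ Lₚ.map-++ (L.map f) (L.map (x ∷_) L₁) _ ⟩
    L.map (L.map f) (L.map (x ∷_) L₁) L.++ L.map (L.map f) (L.map (y ∷_) L₂ L.++ L.map ((x ⊕ᴬ y) ∷_) L₃)
      ≡⟨ cong (L.map (L.map f) (L.map (x ∷_) L₁) L.++_) (Lₚ.map-++ (L.map f) (L.map (y ∷_) L₂) _) ⟩
    L.map (L.map f) (L.map (x ∷_) L₁) L.++ L.map (L.map f) (L.map (y ∷_) L₂) L.++ L.map (L.map f) (L.map ((x ⊕ᴬ y) ∷_) L₃)
      ≡⟨ cong₂ L._++_ (map-map-∷ f x (qsh-map f hom pxs (py ∷ pys)))
           (cong₂ L._++_ (map-map-∷ f y (qsh-map f hom (px ∷ pxs) pys))
             (trans (map-map-∷ f (x ⊕ᴬ y) (qsh-map f hom pxs pys)) (cong (λ z → L.map (z ∷_) (qsh _⊕ᴮ_ (L.map f xs) (L.map f ys))) (hom px py)))) ⟩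
    qsh _⊕ᴮ_ (L.map f (x ∷ xs)) (L.map f (y ∷ ys)) ∎
    where
    open ≡-Reasoning
    L₁ = qsh _⊕ᴬ_ xs (y ∷ ys)
    L₂ = qsh _⊕ᴬ_ (x ∷ xs) ys
    L₃ = qsh _⊕ᴬ_ xs ys

module _ {A : Set} (_⊕_ : A → A → A) {P Q : A → Set} (I : List A → List A → List A → Set) where

  qsh-All : (∀ ys → I [] ys ys) → (∀ x xs → I (x ∷ xs) [] (x ∷ xs)) →
    (∀ {x xs y ys H} → P x → I xs (y ∷ ys) H → I (x ∷ xs) (y ∷ ys) (x ∷ H)) →
    (∀ {x xs y ys H} → Q y → I (x ∷ xs) ys H → I (x ∷ xs) (y ∷ ys) (y ∷ H)) →
    (∀ {x xs y ys H} → P x → Q y → I xs ys H → I (x ∷ xs) (y ∷ ys) ((x ⊕ y) ∷ H)) →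
    ∀ {xs ys} → All P xs → All Q ys → All (I xs ys) (qsh _⊕_ xs ys)
  qsh-All nil₁ nil₂ left right both {[]}     {ys}     _          _          = nil₁ ys ∷ []
  qsh-All nil₁ nil₂ left right both {x ∷ xs} {[]}     _          _          = nil₂ x xs ∷ []
  qsh-All nil₁ nil₂ left right both {x ∷ xs} {y ∷ ys} (px ∷ pxs) (py ∷ pys) =
    Allₚ.++⁺ (Allₚ.map⁺ (All.map (left px) (recurse pxs (py ∷ pys))))
      (Allₚ.++⁺ (Allₚ.map⁺ (All.map (right py) (recurse (px ∷ pxs) pys)))
                (Allₚ.map⁺ (All.map (both px py) (recurse pxs pys))))
    where recurse = qsh-All nil₁ nil₂ left right both

padʳ : ∀ m → Vec Bool n → Vec Bool (n + m)
padʳ m b = b V.++ replicate m false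

padˡ : ∀ n → Vec Bool m → Vec Bool (n + m)
padˡ n c = replicate n false V.++ c

replicate-++ : {A : Set} (n m : ℕ) (x : A) → replicate n x V.++ replicate m x ≡ replicate (n + m) x
replicate-++ zero    m x = refl
replicate-++ (suc n) m x = cong (x ∷_) (replicate-++ n m x)

padʳ-∪-padˡ : (b : Vec Bool n) (c : Vec Bool m) → padʳ m b ∪ padˡ n c ≡ b V.++ c
padʳ-∪-padˡ []      c = Vₚ.zipWith-identityˡ {f = _∨_} (λ _ → refl) c
padʳ-∪-padˡ (β ∷ b) c = cong₂ _∷_ (∨-identityʳ β) (padʳ-∪-padˡ b c)

Disjoint : Vec Bool n → Vec Bool n → Set
Disjoint = Pointwise (λ u v → T (not (u ∧ v)))

padʳ-disjoint-padˡ : (b : Vec Bool n) (c : Vec Bool m) → Disjoint (padʳ m b) (padˡ n c)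
padʳ-disjoint-padˡ []          c = disjoint-empty c
  where
  disjoint-empty : ∀ {m} (c : Vec Bool m) → Disjoint (replicate m false) c
  disjoint-empty []      = []
  disjoint-empty (γ ∷ c) = tt ∷ disjoint-empty c
padʳ-disjoint-padˡ (false ∷ b) c = tt ∷ padʳ-disjoint-padˡ b c
padʳ-disjoint-padˡ (true  ∷ b) c = tt ∷ padʳ-disjoint-padˡ b c

occurrences-∪ : {x y : Vec Bool n} (H : List (Vec Bool n)) → Disjoint x y →
  occurrences ((x ∪ y) ∷ H) ≡ occurrences (x ∷ y ∷ H)
occurrences-∪ H d = go d (occurrences H)
  where
  go : ∀ {n} {x y : Vec Bool n} → Disjoint x y → (X : Vec Occ n) →
    V.zipWith _⊕_ (V.map occ (x ∪ y)) X ≡ V.zipWith _⊕_ (V.map occ x) (V.zipWith _⊕_ (V.map occ y) X)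
  go                         []                  []      = refl
  go {x = false ∷ _}         (_ ∷ d)             (t ∷ X) = cong (_ ∷_) (go d X)
  go {x = true ∷ _} {false ∷ _} (_ ∷ d)          (t ∷ X) = cong (_ ∷_) (go d X)

occurrences-padʳ : ∀ m (bs : List (Vec Bool n)) →
  occurrences (L.map (padʳ m) bs) ≡ occurrences bs V.++ replicate m none
occurrences-padʳ {n} m []       = sym (replicate-++ n m none)
occurrences-padʳ     m (b ∷ bs) = begin
  V.zipWith _⊕_ (V.map occ (b V.++ replicate m false)) (occurrences (L.map (padʳ m) bs))
    ≡⟨ cong₂ (V.zipWith _⊕_) (Vₚ.map-++ occ b _) (occurrences-padʳ m bs) ⟩
  V.zipWith _⊕_ (V.map occ b V.++ V.map occ (replicate m false)) (occurrences bs V.++ replicate m none)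
    ≡⟨ Vₚ.zipWith-++ _⊕_ (V.map occ b) _ (occurrences bs) _ ⟩
  V.zipWith _⊕_ (V.map occ b) (occurrences bs) V.++ V.zipWith _⊕_ (V.map occ (replicate m false)) (replicate m none)
    ≡⟨ cong (V.zipWith _⊕_ (V.map occ b) (occurrences bs) V.++_)
         (trans (cong (λ z → V.zipWith _⊕_ z (replicate m none)) (Vₚ.map-replicate occ false m))
                (Vₚ.zipWith-identityˡ {f = _⊕_} (λ _ → refl) _)) ⟩
  occurrences (b ∷ bs) V.++ replicate m none ∎
  where open ≡-Reasoning

occurrences-padˡ : ∀ n (cs : List (Vec Bool m)) →
  occurrences (L.map (padˡ n) cs) ≡ replicate n none V.++ occurrences cs
occurrences-padˡ {m} n []       = sym (replicate-++ n m none)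
occurrences-padˡ     n (c ∷ cs) = begin
  V.zipWith _⊕_ (V.map occ (replicate n false V.++ c)) (occurrences (L.map (padˡ n) cs))
    ≡⟨ cong₂ (V.zipWith _⊕_) (Vₚ.map-++ occ (replicate n false) c) (occurrences-padˡ n cs) ⟩
  V.zipWith _⊕_ (V.map occ (replicate n false) V.++ V.map occ c) (replicate n none V.++ occurrences cs)
    ≡⟨ Vₚ.zipWith-++ _⊕_ (V.map occ (replicate n false)) _ (replicate n none) _ ⟩
  V.zipWith _⊕_ (V.map occ (replicate n false)) (replicate n none) V.++ V.zipWith _⊕_ (V.map occ c) (occurrences cs)
    ≡⟨ cong (V._++ occurrences (c ∷ cs))
         (trans (cong (λ z → V.zipWith _⊕_ z (replicate n none)) (Vₚ.map-replicate occ false n))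
                (Vₚ.zipWith-identityˡ {f = _⊕_} (λ _ → refl) _)) ⟩
  replicate n none V.++ occurrences (c ∷ cs) ∎
  where open ≡-Reasoning

occurrences-juxtapose : (bs : List (Vec Bool n)) (cs : List (Vec Bool m)) →
  occurrences (L.map (padʳ m) bs L.++ L.map (padˡ n) cs) ≡ occurrences bs V.++ occurrences cs
occurrences-juxtapose {n} {m} bs cs = begin
  occurrences (L.map (padʳ m) bs L.++ L.map (padˡ n) cs)
    ≡⟨ occurrences-++ (L.map (padʳ m) bs) _ ⟩
  V.zipWith _⊕_ (occurrences (L.map (padʳ m) bs)) (occurrences (L.map (padˡ n) cs))
    ≡⟨ cong₂ (V.zipWith _⊕_) (occurrences-padʳ m bs) (occurrences-padˡ n cs) ⟩
  V.zipWith _⊕_ (occurrences bs V.++ replicate m none) (replicate n none V.++ occurrences cs)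
    ≡⟨ Vₚ.zipWith-++ _⊕_ (occurrences bs) _ (replicate n none) _ ⟩
  V.zipWith _⊕_ (occurrences bs) (replicate n none) V.++ V.zipWith _⊕_ (replicate m none) (occurrences cs)
    ≡⟨ cong₂ V._++_ (Vₚ.zipWith-identityʳ {f = _⊕_} ⊕-identityʳ (occurrences bs)) (Vₚ.zipWith-identityˡ {f = _⊕_} (λ _ → refl) (occurrences cs)) ⟩
  occurrences bs V.++ occurrences cs ∎
  where open ≡-Reasoning

nonempty-∪ˡ : (x y : Vec Bool n) → NonemptyBlock x → NonemptyBlock (x ∪ y)
nonempty-∪ˡ (true  ∷ x) (_ ∷ y)     h = tt
nonempty-∪ˡ (false ∷ x) (true ∷ y)  h = tt
nonempty-∪ˡ (false ∷ x) (false ∷ y) h = nonempty-∪ˡ x y h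

nonempty-padʳ : ∀ m (b : Vec Bool n) → NonemptyBlock b → NonemptyBlock (padʳ m b)
nonempty-padʳ m (true  ∷ b) h = tt
nonempty-padʳ m (false ∷ b) h = nonempty-padʳ m b h

nonempty-padˡ : ∀ n (c : Vec Bool m) → NonemptyBlock c → NonemptyBlock (padˡ n c)
nonempty-padˡ zero    c h = h
nonempty-padˡ (suc n) c h = nonempty-padˡ n c h

module Quasishuffle (n m : ℕ) where

  IsPadʳ : Vec Bool (n + m) → Set
  IsPadʳ x = ∃ λ b → x ≡ padʳ m b

  IsPadˡ : Vec Bool (n + m) → Set
  IsPadˡ y = ∃ λ c → y ≡ padˡ n c

  qsh-occurrences : ∀ {xs ys} → All IsPadʳ xs → All IsPadˡ ys →
    All (λ H → occurrences H ≡ occurrences (xs L.++ ys)) (qsh _∪_ xs ys)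
  qsh-occurrences = qsh-All _∪_ (λ xs ys H → occurrences H ≡ occurrences (xs L.++ ys))
    (λ ys → refl)
    (λ x xs → cong occurrences (sym (Lₚ.++-identityʳ (x ∷ xs))))
    (λ {x} _ e → cong (V.zipWith _⊕_ (V.map occ x)) e)
    (λ {x} {xs} {y} {ys} _ e →
      trans (cong (V.zipWith _⊕_ (V.map occ y)) e) (occurrences-↭ (↭-sym (↭ₚ.shift y (x ∷ xs) ys))))
    (λ { {xs = xs} {ys = ys} {H} (b , refl) (c , refl) e →
      trans (occurrences-∪ H (padʳ-disjoint-padˡ b c))
        (trans (cong (λ X → V.zipWith _⊕_ (V.map occ (padʳ m b)) (V.zipWith _⊕_ (V.map occ (padˡ n c)) X)) e)
               (occurrences-↭ (prep (padʳ m b) (↭-sym (↭ₚ.shift (padˡ n c) xs ys))))) })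

  qsh-nonempty : ∀ {xs ys} → All IsPadʳ xs → All IsPadˡ ys →
    All (λ H → All NonemptyBlock xs → All NonemptyBlock ys → All NonemptyBlock H) (qsh _∪_ xs ys)
  qsh-nonempty = qsh-All _∪_ (λ xs ys H → All NonemptyBlock xs → All NonemptyBlock ys → All NonemptyBlock H)
    (λ ys _ h → h)
    (λ x xs h _ → h)
    (λ { _ i (hx ∷ hxs) hys → hx ∷ i hxs hys })
    (λ { _ i hxs (hy ∷ hys) → hy ∷ i hxs hys })
    (λ { {x} {y = y} _ _ i (hx ∷ hxs) (hy ∷ hys) → nonempty-∪ˡ x y hx ∷ i hxs hys })

  isPadʳ : (bs : List (Vec Bool n)) → All IsPadʳ (L.map (padʳ m) bs)
  isPadʳ bs = Allₚ.map⁺ (All.universal (λ b → b , refl) bs)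

  isPadˡ : (cs : List (Vec Bool m)) → All IsPadˡ (L.map (padˡ n) cs)
  isPadˡ cs = Allₚ.map⁺ (All.universal (λ c → c , refl) cs)

  validComp-qsh : (s : Vec Bool n) (t : Vec Bool m) (bs : List (Vec Bool n)) (cs : List (Vec Bool m)) →
    T (validComp (comp s bs)) → T (validComp (comp t cs)) →
    All (λ H → T (validComp (comp (s V.++ t) H))) (qsh _∪_ (L.map (padʳ m) bs) (L.map (padˡ n) cs))
  validComp-qsh s t bs cs vF vG =
    All.zipWith valid (qsh-occurrences (isPadʳ bs) (isPadˡ cs) , qsh-nonempty (isPadʳ bs) (isPadˡ cs))
    where
    neF = proj₁ (Equivalence.to (validComp⇔ s bs) vF)
    neG = proj₁ (Equivalence.to (validComp⇔ t cs) vG)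
    exact : ExactCover (L.map (padʳ m) bs L.++ L.map (padˡ n) cs)
    exact = subst (AllV (_≡ once)) (sym (occurrences-juxtapose bs cs))
      (VAllₚ.++⁺ (proj₂ (Equivalence.to (validComp⇔ s bs) vF)) (proj₂ (Equivalence.to (validComp⇔ t cs) vG)))
    valid : ∀ {H} → occurrences H ≡ occurrences (L.map (padʳ m) bs L.++ L.map (padˡ n) cs) ×
      (All NonemptyBlock (L.map (padʳ m) bs) → All NonemptyBlock (L.map (padˡ n) cs) → All NonemptyBlock H) →
      T (validComp (comp (s V.++ t) H))
    valid {H} (e , ne) = Equivalence.from (validComp⇔ (s V.++ t) H)
      ( ne (Allₚ.map⁺ (All.map (λ {b} → nonempty-padʳ m b) neF)) (Allₚ.map⁺ (All.map (λ {c} → nonempty-padˡ n c) neG))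
      , subst (AllV (_≡ once)) (sym e) exact)

columnsOf-prodComp : ∀ F G → L.map columnsOf (prodComp F G) ≡ prodBi (columnsOf F) (columnsOf G)
columnsOf-prodComp (n , comp s bs , vF) (m , comp t cs , vG) = begin
  L.map columnsOf (concatMap (λ H → mkComp (comp (s V.++ t) H)) Qs)
    ≡⟨ Lₚ.map-concatMap columnsOf _ Qs ⟩
  concatMap (λ H → L.map columnsOf (mkComp (comp (s V.++ t) H))) Qs
    ≡⟨ cong L.concat (Lₚ.map-cong-local (All.map (λ {H} v →
         trans (cong (L.map columnsOf) (mkComp-valid _ v)) (sym (mkBi-valid _ _))) (validComp-qsh s t bs cs vF vG))) ⟩
  concatMap (λ H → mkBi (L.map (column (s V.++ t)) H)) Qs
    ≡⟨ Lₚ.concatMap-map mkBi (L.map (column (s V.++ t))) Qs ⟨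
  concatMap mkBi (L.map (L.map (column (s V.++ t))) Qs)
    ≡⟨ cong (concatMap mkBi) (qsh-map (column (s V.++ t)) column-∪ (isPadʳ bs) (isPadˡ cs)) ⟩
  concatMap mkBi (qsh addCol (L.map (column (s V.++ t)) (L.map (padʳ m) bs)) (L.map (column (s V.++ t)) (L.map (padˡ n) cs)))
    ≡⟨ cong (concatMap mkBi) (cong₂ (qsh addCol)
         (trans (sym (Lₚ.map-∘ bs)) (Lₚ.map-cong (column-padʳ s t) bs))
         (trans (sym (Lₚ.map-∘ cs)) (Lₚ.map-cong (column-padˡ s t) cs))) ⟩
  concatMap mkBi (qsh addCol (L.map (column s) bs) (L.map (column t) cs)) ∎
  where
  open ≡-Reasoning
  open Quasishuffle n m
  Qs = qsh _∪_ (L.map (padʳ m) bs) (L.map (padˡ n) cs)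
  column-∪ : ∀ {x y} → IsPadʳ x → IsPadˡ y → column (s V.++ t) (x ∪ y) ≡ addCol (column (s V.++ t) x) (column (s V.++ t) y)
  column-∪ (b , refl) (c , refl) = begin
    column (s V.++ t) (padʳ m b ∪ padˡ n c) ≡⟨ cong (column (s V.++ t)) (padʳ-∪-padˡ b c) ⟩
    column (s V.++ t) (b V.++ c)            ≡⟨ column-++ s b t c ⟩
    addCol (column s b) (column t c)        ≡⟨ cong₂ addCol (column-padʳ s t b) (column-padˡ s t c) ⟨
    addCol (column (s V.++ t) (padʳ m b)) (column (s V.++ t) (padˡ n c)) ∎

-- Standardization and coproducts

support : List (Vec Bool n) → Vec Bool n
support = L.foldr _∪_ (replicate _ false)

support≡occurs : (P : List (Vec Bool n)) → support P ≡ V.map occurs (occurrences P)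
support≡occurs []      = sym (Vₚ.map-replicate occurs none _)
support≡occurs (b ∷ P) = trans (cong (b ∪_) (support≡occurs P)) (pointwise b (occurrences P))
  where
  pointwise : ∀ {n} (b : Vec Bool n) (X : Vec Occ n) → b ∪ V.map occurs X ≡ V.map occurs (V.zipWith _⊕_ (V.map occ b) X)
  pointwise []          []         = refl
  pointwise (false ∷ b) (x ∷ X)    = cong (_ ∷_) (pointwise b X)
  pointwise (true ∷ b)  (none ∷ X) = cong (_ ∷_) (pointwise b X)
  pointwise (true ∷ b)  (once ∷ X) = cong (_ ∷_) (pointwise b X)
  pointwise (true ∷ b)  (many ∷ X) = cong (_ ∷_) (pointwise b X)

_⊆_ : Vec Bool n → Vec Bool n → Set
_⊆_ = Pointwise (λ β υ → T β → T υ)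

⊆-∪ʳ : {x W : Vec Bool n} (b : Vec Bool n) → x ⊆ W → x ⊆ (b ∪ W)
⊆-∪ʳ []          []      = []
⊆-∪ʳ (false ∷ b) (h ∷ p) = h ∷ ⊆-∪ʳ b p
⊆-∪ʳ (true ∷ b)  (h ∷ p) = (λ _ → tt) ∷ ⊆-∪ʳ b p

⊆-∪ˡ : (b W : Vec Bool n) → b ⊆ (b ∪ W)
⊆-∪ˡ []          []      = []
⊆-∪ˡ (false ∷ b) (w ∷ W) = (λ ()) ∷ ⊆-∪ˡ b W
⊆-∪ˡ (true ∷ b)  (w ∷ W) = (λ _ → tt) ∷ ⊆-∪ˡ b W

⊆-support : (P : List (Vec Bool n)) → All (_⊆ support P) P
⊆-support []      = []
⊆-support (b ∷ P) = ⊆-∪ˡ b (support P) ∷ All.map (⊆-∪ʳ b) (⊆-support P)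

compress-zipWith : {A B C : Set} (f : A → B → C) (x : Vec A n) (y : Vec B n) (U : Vec Bool n) →
  compress (V.zipWith f x y) U ≡ V.zipWith f (compress x U) (compress y U)
compress-zipWith f []      []      []         = refl
compress-zipWith f (a ∷ x) (b ∷ y) (true ∷ U)  = cong (f a b ∷_) (compress-zipWith f x y U)
compress-zipWith f (a ∷ x) (b ∷ y) (false ∷ U) = compress-zipWith f x y U

compress-map : {A B : Set} (f : A → B) (x : Vec A n) (U : Vec Bool n) → compress (V.map f x) U ≡ V.map f (compress x U)
compress-map f []      []          = refl
compress-map f (a ∷ x) (true ∷ U)  = cong (f a ∷_) (compress-map f x U)
compress-map f (a ∷ x) (false ∷ U) = compress-map f x U

compress-replicate : {A : Set} (a : A) (U : Vec Bool n) → compress (replicate n a) U ≡ replicate (count U) a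
compress-replicate a []          = refl
compress-replicate a (true ∷ U)  = cong (a ∷_) (compress-replicate a U)
compress-replicate a (false ∷ U) = compress-replicate a U

occurrences-compress : (P : List (Vec Bool n)) (U : Vec Bool n) →
  occurrences (L.map (λ b → compress b U) P) ≡ compress (occurrences P) U
occurrences-compress []      U = sym (compress-replicate none U)
occurrences-compress (b ∷ P) U = begin
  V.zipWith _⊕_ (V.map occ (compress b U)) (occurrences (L.map (λ b → compress b U) P))
    ≡⟨ cong₂ (V.zipWith _⊕_) (sym (compress-map occ b U)) (occurrences-compress P U) ⟩
  V.zipWith _⊕_ (compress (V.map occ b) U) (compress (occurrences P) U)
    ≡⟨ compress-zipWith _⊕_ (V.map occ b) (occurrences P) U ⟨
  compress (occurrences (b ∷ P)) U ∎
  where open ≡-Reasoning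

column-compress : (s b U : Vec Bool n) → b ⊆ U → column (compress s U) (compress b U) ≡ column s b
column-compress s b U b⊆U = cong₂ _,_ (countSign-compress false s b U b⊆U) (countSign-compress true s b U b⊆U)
  where
  countSign-compress : ∀ {n} τ (s b U : Vec Bool n) → b ⊆ U → countSign τ (compress s U) (compress b U) ≡ countSign τ s b
  countSign-compress τ []      []          []          []      = refl
  countSign-compress τ (σ ∷ s) (β ∷ b)     (true ∷ U)  (_ ∷ p) = cong (signedHit τ σ β +_) (countSign-compress τ s b U p)
  countSign-compress τ (σ ∷ s) (false ∷ b) (false ∷ U) (_ ∷ p) = countSign-compress τ s b U p
  countSign-compress τ (σ ∷ s) (true ∷ b)  (false ∷ U) (h ∷ p) = ⊥-elim (h tt)

nonempty-compress : (b U : Vec Bool n) → b ⊆ U → NonemptyBlock b → NonemptyBlock (compress b U)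
nonempty-compress (true ∷ b)  (true ∷ U)  _       _ = tt
nonempty-compress (true ∷ b)  (false ∷ U) (h ∷ _) _ = ⊥-elim (h tt)
nonempty-compress (false ∷ b) (true ∷ U)  (_ ∷ p) h = nonempty-compress b U p h
nonempty-compress (false ∷ b) (false ∷ U) (_ ∷ p) h = nonempty-compress b U p h

ExactCoverOfSupport : List (Vec Bool n) → Set
ExactCoverOfSupport P = AllV (_≡ once) (compress (occurrences P) (support P))

exactCoverOfSupportˡ : (X Y : Vec Occ n) → AllV (_≡ once) (V.zipWith _⊕_ X Y) →
  AllV (_≡ once) (compress X (V.map occurs X))
exactCoverOfSupportˡ []         []         []      = []
exactCoverOfSupportˡ (none ∷ X) (y ∷ Y)    (_ ∷ h) = exactCoverOfSupportˡ X Y h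
exactCoverOfSupportˡ (once ∷ X) (none ∷ Y) (_ ∷ h) = refl ∷ exactCoverOfSupportˡ X Y h
exactCoverOfSupportˡ (once ∷ X) (once ∷ Y) (() ∷ _)
exactCoverOfSupportˡ (once ∷ X) (many ∷ Y) (() ∷ _)
exactCoverOfSupportˡ (many ∷ X) (y ∷ Y)    (() ∷ _)

exactCover-++ : (P S : List (Vec Bool n)) → ExactCover (P L.++ S) → ExactCoverOfSupport P × ExactCoverOfSupport S
exactCover-++ P S h =
    onSupport P (exactCoverOfSupportˡ (occurrences P) (occurrences S) h′)
  , onSupport S (exactCoverOfSupportˡ (occurrences S) (occurrences P)
      (subst (AllV (_≡ once)) (Vₚ.zipWith-comm {f = _⊕_} ⊕-comm (occurrences P) _) h′))
  where
  h′ = subst (AllV (_≡ once)) (occurrences-++ P S) h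
  onSupport : ∀ Q → AllV (_≡ once) (compress (occurrences Q) (V.map occurs (occurrences Q))) → ExactCoverOfSupport Q
  onSupport Q = subst (λ U → AllV (_≡ once) (compress (occurrences Q) U)) (sym (support≡occurs Q))

columnsOf-st : (s : Vec Bool n) (P : List (Vec Bool n)) → All NonemptyBlock P → ExactCoverOfSupport P →
  L.map columnsOf (st s P) ≡ mkBi (L.map (column s) P)
columnsOf-st {n} s P ne exact = begin
  L.map columnsOf (mkComp F)                        ≡⟨ cong (L.map columnsOf) (mkComp-valid F valid) ⟩
  [ columnsOf (_ , F , valid) ]                     ≡⟨ cong [_] (BiComp-≡ columns≡) ⟩
  [ (L.map (column s) P , columns-nonzero s P ne) ] ≡⟨ mkBi-valid _ _ ⟨
  mkBi (L.map (column s) P) ∎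
  where
  open ≡-Reasoning
  U = support P
  P′ = L.map (λ b → compress b U) P
  F = comp (compress s U) P′
  valid : T (validComp F)
  valid = Equivalence.from (validComp⇔ (compress s U) P′)
    ( Allₚ.map⁺ (All.zipWith (λ {b} (p , h) → nonempty-compress b U p h) (⊆-support P , ne))
    , subst (AllV (_≡ once)) (sym (occurrences-compress P U)) exact)
  columns≡ : L.map (column (compress s U)) P′ ≡ L.map (column s) P
  columns≡ = trans (sym (Lₚ.map-∘ P)) (Lₚ.map-cong-local (All.map (λ {b} → column-compress s b U) (⊆-support P)))

splits-map : {A B : Set} (f : A → B) (xs : List A) →
  splits (L.map f xs) ≡ L.map (λ p → (L.map f (proj₁ p) , L.map f (proj₂ p))) (splits xs)
splits-map f []       = refl
splits-map f (x ∷ xs) = cong (([] , f x ∷ L.map f xs) ∷_)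
  (trans (cong (L.map (λ p → (f x ∷ proj₁ p , proj₂ p))) (splits-map f xs))
    (trans (sym (Lₚ.map-∘ (splits xs))) (Lₚ.map-∘ (splits xs))))

splits-++ : {A : Set} (xs : List A) → All (λ p → proj₁ p L.++ proj₂ p ≡ xs) (splits xs)
splits-++ []       = refl ∷ []
splits-++ (x ∷ xs) = refl ∷ Allₚ.map⁺ (All.map (cong (x ∷_)) (splits-++ xs))

pairs : {A B : Set} → List A → List B → List (A × B)
pairs xs ys = concatMap (λ x → L.map (λ y → (x , y)) ys) xs

pairs-map : {A B : Set} (f : A → B) (xs ys : List A) →
  L.map (λ q → (f (proj₁ q) , f (proj₂ q))) (pairs xs ys) ≡ pairs (L.map f xs) (L.map f ys)
pairs-map f []       ys = refl
pairs-map f (x ∷ xs) ys = trans (Lₚ.map-++ _ (L.map (λ y → (x , y)) ys) (pairs xs ys))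
  (cong₂ L._++_ (trans (sym (Lₚ.map-∘ ys)) (Lₚ.map-∘ ys)) (pairs-map f xs ys))

columnsOf² : Comp × Comp → BiComp × BiComp
columnsOf² q = (columnsOf (proj₁ q) , columnsOf (proj₂ q))

columnsOf-copComp : ∀ F → L.map columnsOf² (copComp F) ≡ copBi (columnsOf F)
columnsOf-copComp (n , comp s bs , v) = begin
  L.map columnsOf² (concatMap stPairs (splits bs))
    ≡⟨ Lₚ.map-concatMap columnsOf² stPairs (splits bs) ⟩
  concatMap (L.map columnsOf² ∘ stPairs) (splits bs)
    ≡⟨ cong L.concat (Lₚ.map-cong-local (All.map (λ {q} → perSplit q) (splits-++ bs))) ⟩
  concatMap (biPairs ∘ columnPair) (splits bs)
    ≡⟨ Lₚ.concatMap-map biPairs columnPair (splits bs) ⟨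
  concatMap biPairs (L.map columnPair (splits bs))
    ≡⟨ cong (concatMap biPairs) (splits-map (column s) bs) ⟨
  concatMap biPairs (splits (L.map (column s) bs)) ∎
  where
  open ≡-Reasoning
  stPairs : List (Vec Bool n) × List (Vec Bool n) → List (Comp × Comp)
  stPairs q = pairs (st s (proj₁ q)) (st s (proj₂ q))
  biPairs : List (ℕ × ℕ) × List (ℕ × ℕ) → List (BiComp × BiComp)
  biPairs q = pairs (mkBi (proj₁ q)) (mkBi (proj₂ q))
  columnPair : List (Vec Bool n) × List (Vec Bool n) → List (ℕ × ℕ) × List (ℕ × ℕ)
  columnPair q = (L.map (column s) (proj₁ q) , L.map (column s) (proj₂ q))
  perSplit : ∀ q → proj₁ q L.++ proj₂ q ≡ bs → L.map columnsOf² (stPairs q) ≡ biPairs (columnPair q)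
  perSplit (P , S) refl =
    let (ne , exact) = Equivalence.to (validComp⇔ s (P L.++ S)) v
        (exactP , exactS) = exactCover-++ P S exact
    in trans (pairs-map columnsOf (st s P) (st s S))
             (cong₂ pairs (columnsOf-st s P (Allₚ.++⁻ˡ P ne) exactP) (columnsOf-st s S (Allₚ.++⁻ʳ P ne) exactS))

-- Canonical representatives: the column (α , β) becomes a block of α positive
-- elements followed by β negative ones, blocks filling [n] from left to right.

degree : List (ℕ × ℕ) → ℕ
degree []            = 0
degree ((a , b) ∷ c) = (a + b) + degree c

canonicalRaw : (c : List (ℕ × ℕ)) → RawComp (degree c)
canonicalRaw []            = comp [] []
canonicalRaw ((a , b) ∷ c) =
  comp ((replicate a false V.++ replicate b true) V.++ RawComp.sect (canonicalRaw c))
       (padʳ (degree c) (replicate (a + b) true) ∷ L.map (padˡ (a + b)) (RawComp.blocks (canonicalRaw c)))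

canonical-nonempty : ∀ c → T (allL (L.map nonzeroCol c)) → All NonemptyBlock (RawComp.blocks (canonicalRaw c))
canonical-nonempty []            _ = []
canonical-nonempty ((a , b) ∷ c) h =
  ones-nonempty a b (proj₁ nz) ∷ Allₚ.map⁺ (All.map (λ {x} → nonempty-padˡ (a + b) x) (canonical-nonempty c (proj₂ nz)))
  where
  nz = Equivalence.to T-∧ h
  ones-nonempty : ∀ a b → T (nonzeroCol (a , b)) → NonemptyBlock (padʳ (degree c) (replicate (a + b) true))
  ones-nonempty (suc a) b    _ = tt
  ones-nonempty zero (suc b) _ = tt

canonical-exactCover : ∀ c → ExactCover (RawComp.blocks (canonicalRaw c))
canonical-exactCover []            = []
canonical-exactCover ((a , b) ∷ c) =
  subst (AllV (_≡ once)) (sym (occurrences-juxtapose [ replicate (a + b) true ] (RawComp.blocks (canonicalRaw c))))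
    (VAllₚ.++⁺ (ones (a + b)) (canonical-exactCover c))
  where
  ones : ∀ k → AllV (_≡ once) (occurrences [ replicate k true ])
  ones zero    = []
  ones (suc k) = refl ∷ ones k

canonical-valid : ∀ c → T (allL (L.map nonzeroCol c)) → T (validComp (canonicalRaw c))
canonical-valid c h = Equivalence.from (validComp⇔ (RawComp.sect (canonicalRaw c)) _) (canonical-nonempty c h , canonical-exactCover c)

columns-canonical : ∀ c → L.map (column (RawComp.sect (canonicalRaw c))) (RawComp.blocks (canonicalRaw c)) ≡ c
columns-canonical []            = refl
columns-canonical ((a , b) ∷ c) = cong₂ _∷_ head≡ (trans (sym (Lₚ.map-∘ bs)) (trans (Lₚ.map-cong (column-padˡ signs s) bs) (columns-canonical c)))
  where
  open ≡-Reasoning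
  signs = replicate a false V.++ replicate b true
  s = RawComp.sect (canonicalRaw c)
  bs = RawComp.blocks (canonicalRaw c)
  positives : ∀ k → column (replicate k false) (replicate k true) ≡ (k , 0)
  positives zero    = refl
  positives (suc k) = cong (λ z → (suc (proj₁ z) , proj₂ z)) (positives k)
  negatives : ∀ k → column (replicate k true) (replicate k true) ≡ (0 , k)
  negatives zero    = refl
  negatives (suc k) = cong (λ z → (proj₁ z , suc (proj₂ z))) (negatives k)
  head≡ : column (signs V.++ s) (padʳ (degree c) (replicate (a + b) true)) ≡ (a , b)
  head≡ = begin
    column (signs V.++ s) (padʳ (degree c) (replicate (a + b) true)) ≡⟨ column-padʳ signs s _ ⟩
    column signs (replicate (a + b) true)                            ≡⟨ cong (column signs) (replicate-++ a b true) ⟨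
    column signs (replicate a true V.++ replicate b true)            ≡⟨ column-++ (replicate a false) _ (replicate b true) _ ⟩
    addCol (column (replicate a false) (replicate a true)) (column (replicate b true) (replicate b true))
      ≡⟨ cong₂ addCol (positives a) (negatives b) ⟩
    (a + 0 , b)                                                      ≡⟨ cong (_, b) (ℕₚ.+-identityʳ a) ⟩
    (a , b) ∎

canonical : BiComp → Comp
canonical (c , nz) = (degree c , canonicalRaw c , canonical-valid c nz)

columnsOf-canonical : ∀ x → columnsOf (canonical x) ≡ x
columnsOf-canonical (c , nz) = BiComp-≡ (columns-canonical c)

permV-∘ : {A : Set} (π₁ π₂ : Permutation′ n) (v : Vec A n) → permV (π₁ ∘ₚ π₂) v ≡ permV π₂ (permV π₁ v)
permV-∘ π₁ π₂ v = Vₚ.tabulate-cong (λ j → sym (Vₚ.lookup∘tabulate _ (π₂ ⟨$⟩ˡ j)))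

permV-map : {A B : Set} (π : Permutation′ n) (f : A → B) (v : Vec A n) → permV π (V.map f v) ≡ V.map f (permV π v)
permV-map π f v = trans (Vₚ.tabulate-cong (λ j → Vₚ.lookup-map (π ⟨$⟩ˡ j) f v)) (Vₚ.tabulate-∘ f (λ j → lookup v (π ⟨$⟩ˡ j)))

↭⇒permutation : {A : Set} {K L : List A} → K ↭ L → (xs : Vec A n) → V.toList xs ≡ K →
  ∃ λ (π : Permutation′ n) → V.toList (permV π xs) ≡ L
↭⇒permutation ↭.refl        xs e = Perm.id , trans (cong V.toList (Vₚ.tabulate∘lookup xs)) e
↭⇒permutation (prep x p)    (y ∷ xs) refl =
  let (π , e) = ↭⇒permutation p xs refl in lift₀ π , cong (x ∷_) e
↭⇒permutation (swap x y p)  (u ∷ w ∷ xs) refl =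
  let (π , e) = ↭⇒permutation p xs refl
  in transpose zero (suc zero) ∘ₚ lift₀ (lift₀ π) ,
     trans (cong V.toList (permV-∘ (transpose zero (suc zero)) (lift₀ (lift₀ π)) (u ∷ w ∷ xs)))
           (cong (λ z → y ∷ x ∷ z) (trans (cong (V.toList ∘ permV π) (Vₚ.tabulate∘lookup xs)) e))
↭⇒permutation (↭.trans p q) xs e =
  let (π₁ , e₁) = ↭⇒permutation p xs e
      (π₂ , e₂) = ↭⇒permutation q (permV π₁ xs) e₁
  in π₁ ∘ₚ π₂ , trans (cong V.toList (permV-∘ π₁ π₂ xs)) e₂

toList-injective : {A : Set} (v : Vec A n) (w : Vec A m) → V.toList v ≡ V.toList w →
  _≡_ {A = Σ ℕ (Vec A)} (n , v) (m , w)
toList-injective []      []      _    = refl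
toList-injective (x ∷ v) (y ∷ w) e with Lₚ.∷-injective e
... | refl , e′ with toList-injective v w e′
... | refl = refl

-- Profiles: a composition is recovered from the sign of each element together with
-- the list of its memberships in the blocks; these profiles are permuted by 𝔖ₙ.

Profile : Set
Profile = Bool × List Bool

memberships : List (Vec Bool n) → Vec (List Bool) n
memberships []       = replicate _ []
memberships (b ∷ bs) = V.zipWith _∷_ b (memberships bs)

profiles : Vec Bool n → List (Vec Bool n) → Vec Profile n
profiles s bs = V.zipWith _,_ s (memberships bs)

head : List Bool → Bool
head []      = false
head (x ∷ _) = x

tail : List Bool → List Bool
tail []       = []
tail (_ ∷ xs) = xs

rows : ℕ → Vec (List Bool) n → List (Vec Bool n)
rows zero    C = []
rows (suc k) C = V.map head C ∷ rows k (V.map tail C)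

decode : ℕ → Vec Profile n → RawComp n
decode k ps = comp (V.map proj₁ ps) (rows k (V.map proj₂ ps))

decode-profiles : (s : Vec Bool n) (bs : List (Vec Bool n)) {k : ℕ} → L.length bs ≡ k → decode k (profiles s bs) ≡ comp s bs
decode-profiles s bs refl = cong₂ comp (map-proj₁ s (memberships bs))
  (trans (cong (rows (L.length bs)) (map-proj₂ s (memberships bs))) (rows-memberships bs))
  where
  map-proj₁ : ∀ {n} {B : Set} (s : Vec Bool n) (C : Vec B n) → V.map proj₁ (V.zipWith _,_ s C) ≡ s
  map-proj₁ []      []      = refl
  map-proj₁ (x ∷ s) (_ ∷ C) = cong (x ∷_) (map-proj₁ s C)
  map-proj₂ : ∀ {n} {B : Set} (s : Vec Bool n) (C : Vec B n) → V.map proj₂ (V.zipWith _,_ s C) ≡ C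
  map-proj₂ []      []      = refl
  map-proj₂ (_ ∷ s) (c ∷ C) = cong (c ∷_) (map-proj₂ s C)
  map-head : ∀ {n} (b : Vec Bool n) C → V.map head (V.zipWith _∷_ b C) ≡ b
  map-head []      []      = refl
  map-head (x ∷ b) (_ ∷ C) = cong (x ∷_) (map-head b C)
  map-tail : ∀ {n} (b : Vec Bool n) C → V.map tail (V.zipWith _∷_ b C) ≡ C
  map-tail []      []      = refl
  map-tail (_ ∷ b) (c ∷ C) = cong (c ∷_) (map-tail b C)
  rows-memberships : ∀ {n} (bs : List (Vec Bool n)) → rows (L.length bs) (memberships bs) ≡ bs
  rows-memberships []       = refl
  rows-memberships (b ∷ bs) = cong₂ _∷_ (map-head b (memberships bs))
    (trans (cong (rows (L.length bs)) (map-tail b (memberships bs))) (rows-memberships bs))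

decode-permute : ∀ k (π : Permutation′ n) ps → decode k (permV π ps) ≡ act π (decode k ps)
decode-permute k π ps = cong₂ comp (sym (permV-map π proj₁ ps))
  (trans (cong (rows k) (sym (permV-map π proj₂ ps))) (rows-permute k (V.map proj₂ ps)))
  where
  rows-permute : ∀ k C → rows k (permV π C) ≡ L.map (permV π) (rows k C)
  rows-permute zero    C = refl
  rows-permute (suc k) C = cong₂ _∷_ (sym (permV-map π head C))
    (trans (cong (rows k) (sym (permV-map π tail C))) (rows-permute k (V.map tail C)))

-- The multiset of profiles of a set composition is determined by its columns.

columnProfiles : List (ℕ × ℕ) → List Profile
columnProfiles []            = []
columnProfiles ((a , b) ∷ c) =
  L.replicate a (false , true ∷ L.replicate (L.length c) false) L.++
  L.replicate b (true , true ∷ L.replicate (L.length c) false) L.++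
  L.map (λ (σ , hs) → (σ , false ∷ hs)) (columnProfiles c)

elementColumn : Bool → Bool → ℕ × ℕ
elementColumn σ β = (signedHit false σ β , signedHit true σ β)

insertElement : Bool → List Bool → List (ℕ × ℕ) → List (ℕ × ℕ)
insertElement σ = L.zipWith (λ h col → addCol (elementColumn σ h) col)

insertElement-absent : ∀ σ (cs : List (ℕ × ℕ)) → insertElement σ (L.replicate (L.length cs) false) cs ≡ cs
insertElement-absent σ []       = refl
insertElement-absent σ (c ∷ cs) = cong (c ∷_) (insertElement-absent σ cs)

length-insertElement : ∀ σ hs (cs : List (ℕ × ℕ)) → L.length hs ≡ L.length cs → L.length (insertElement σ hs cs) ≡ L.length cs
length-insertElement σ hs cs e = trans (Lₚ.length-zipWith _ hs cs) (trans (cong (ℕ._⊓ L.length cs) e) (ℕₚ.⊓-idem _))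

tally-none : ∀ hs → tally hs ≡ none → hs ≡ L.replicate (L.length hs) false
tally-none []           _ = refl
tally-none (false ∷ hs) e = cong (false ∷_) (tally-none hs e)
tally-none (true ∷ hs)  e with tally hs
tally-none (true ∷ hs)  () | none
tally-none (true ∷ hs)  () | once
tally-none (true ∷ hs)  () | many

once⊕≡once⇒none : ∀ t → once ⊕ t ≡ once → t ≡ none
once⊕≡once⇒none none _ = refl

columnProfiles-insert : ∀ σ hs (cs : List (ℕ × ℕ)) → tally hs ≡ once → L.length hs ≡ L.length cs →
  columnProfiles (insertElement σ hs cs) ↭ (σ , hs) ∷ columnProfiles cs
columnProfiles-insert σ (true ∷ hs) ((a , b) ∷ cs) t e
  rewrite trans (tally-none hs (once⊕≡once⇒none _ t)) (cong (λ k → L.replicate k false) (ℕₚ.suc-injective e))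
        | insertElement-absent σ cs
  with σ
... | false = ↭-refl
... | true  = ↭ₚ.shift _ (L.replicate a (false , true ∷ L.replicate (L.length cs) false)) _
columnProfiles-insert σ (false ∷ hs) ((a , b) ∷ cs) t e
  rewrite length-insertElement σ hs cs (ℕₚ.suc-injective e) = begin
    X L.++ Y L.++ L.map shift (columnProfiles (insertElement σ hs cs))
      ↭⟨ ↭ₚ.++⁺ˡ X (↭ₚ.++⁺ˡ Y (↭ₚ.map⁺ shift (columnProfiles-insert σ hs cs t (ℕₚ.suc-injective e)))) ⟩
    X L.++ Y L.++ (σ , false ∷ hs) ∷ L.map shift (columnProfiles cs)
      ≡⟨ Lₚ.++-assoc X Y _ ⟨
    (X L.++ Y) L.++ (σ , false ∷ hs) ∷ L.map shift (columnProfiles cs)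
      ↭⟨ ↭ₚ.shift (σ , false ∷ hs) (X L.++ Y) _ ⟩
    (σ , false ∷ hs) ∷ (X L.++ Y) L.++ L.map shift (columnProfiles cs)
      ≡⟨ cong ((σ , false ∷ hs) ∷_) (Lₚ.++-assoc X Y _) ⟩
    (σ , false ∷ hs) ∷ X L.++ Y L.++ L.map shift (columnProfiles cs) ∎
  where
  open ↭.PermutationReasoning
  shift : Profile → Profile
  shift (σ , hs) = (σ , false ∷ hs)
  X = L.replicate a (false , true ∷ L.replicate (L.length cs) false)
  Y = L.replicate b (true , true ∷ L.replicate (L.length cs) false)

occurrences-suc : (bs : List (Vec Bool (suc n))) → occurrences bs ≡ tally (L.map V.head bs) ∷ occurrences (L.map V.tail bs)
occurrences-suc []             = refl
occurrences-suc ((x ∷ b) ∷ bs) = cong (V.zipWith _⊕_ (V.map occ (x ∷ b))) (occurrences-suc bs)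
memberships-suc : (bs : List (Vec Bool (suc n))) → memberships bs ≡ L.map V.head bs ∷ memberships (L.map V.tail bs)
memberships-suc []             = refl
memberships-suc ((x ∷ b) ∷ bs) = cong (V.zipWith _∷_ (x ∷ b)) (memberships-suc bs)
columns-suc : ∀ σ (s : Vec Bool n) (bs : List (Vec Bool (suc n))) →
  L.map (column (σ ∷ s)) bs ≡ insertElement σ (L.map V.head bs) (L.map (column s) (L.map V.tail bs))
columns-suc σ s []             = refl
columns-suc σ s ((x ∷ b) ∷ bs) = cong (_ ∷_) (columns-suc σ s bs)

profiles↭columnProfiles : (s : Vec Bool n) (bs : List (Vec Bool n)) → ExactCover bs →
  V.toList (profiles s bs) ↭ columnProfiles (L.map (column s) bs)
profiles↭columnProfiles []      bs _ = ↭-reflexive (trans (noElements bs) (sym (noColumns bs)))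
  where
  noElements : (bs : List (Vec Bool 0)) → V.toList (profiles [] bs) ≡ []
  noElements bs with memberships bs
  ... | [] = refl
  noColumns : (bs : List (Vec Bool 0)) → columnProfiles (L.map (column []) bs) ≡ []
  noColumns []       = refl
  noColumns ([] ∷ bs) = cong (L.map _) (noColumns bs)
profiles↭columnProfiles (σ ∷ s) bs exact = begin
  V.toList (profiles (σ ∷ s) bs)
    ≡⟨ cong (V.toList ∘ V.zipWith _,_ (σ ∷ s)) (memberships-suc bs) ⟩
  (σ , hs) ∷ V.toList (profiles s (L.map V.tail bs))
    ↭⟨ prep (σ , hs) (profiles↭columnProfiles s (L.map V.tail bs) rest) ⟩
  (σ , hs) ∷ columnProfiles (L.map (column s) (L.map V.tail bs))
    ↭⟨ columnProfiles-insert σ hs _ first lengths ⟨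
  columnProfiles (insertElement σ hs (L.map (column s) (L.map V.tail bs)))
    ≡⟨ cong columnProfiles (columns-suc σ s bs) ⟨
  columnProfiles (L.map (column (σ ∷ s)) bs) ∎
  where
  open ↭.PermutationReasoning
  hs = L.map V.head bs
  exact′ = subst (AllV (_≡ once)) (occurrences-suc bs) exact
  first = VAll.head exact′
  rest = VAll.tail exact′
  lengths : L.length hs ≡ L.length (L.map (column s) (L.map V.tail bs))
  lengths = trans (Lₚ.length-map V.head bs) (sym (trans (Lₚ.length-map (column s) (L.map V.tail bs)) (Lₚ.length-map V.tail bs)))

columnsOf-orbit : ∀ {F G} → Orbit F G → columnsOf F ≡ columnsOf G
columnsOf-orbit (orb π (comp s bs) _ _) =
  BiComp-≡ (sym (trans (sym (Lₚ.map-∘ bs)) (Lₚ.map-cong (column-permute π s) bs)))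

orbit-≡ : (F : RawComp n) (p : T (validComp F)) (π : Permutation′ n) (G : RawComp m) (q : T (validComp G)) →
  _≡_ {A = Σ ℕ RawComp} (n , act π F) (m , G) → Orbit (n , F , p) (m , G , q)
orbit-≡ F p π G q refl = orb π F p q

orbit-canonical : ∀ F → Orbit F (canonical (columnsOf F))
orbit-canonical (n , comp s bs , v) = orbit-≡ (comp s bs) v π G (canonical-valid c nz) (begin
  (n , act π (comp s bs))
    ≡⟨ cong (n ,_) (trans (decode-permute k π (profiles s bs)) (cong (act π) (decode-profiles s bs refl))) ⟨
  (n , decode k (permV π (profiles s bs)))
    ≡⟨ cong (λ (m , ps) → (m , decode k ps)) (toList-injective (permV π (profiles s bs)) (profiles sG bG) toList≡) ⟩
  (degree c , decode k (profiles sG bG))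
    ≡⟨ cong (degree c ,_) (decode-profiles sG bG lengthG) ⟩
  (degree c , G) ∎)
  where
  open ≡-Reasoning
  c = L.map (column s) bs
  nz = proj₂ (columnsOf (n , comp s bs , v))
  k = L.length bs
  G = canonicalRaw c
  sG = RawComp.sect G
  bG = RawComp.blocks G
  lengthG : L.length bG ≡ k
  lengthG = trans (sym (Lₚ.length-map (column sG) bG)) (trans (cong L.length (columns-canonical c)) (Lₚ.length-map (column s) bs))
  sameProfiles : V.toList (profiles s bs) ↭ V.toList (profiles sG bG)
  sameProfiles = ↭-trans (profiles↭columnProfiles s bs (proj₂ (Equivalence.to (validComp⇔ s bs) v)))
    (↭-sym (↭-trans (profiles↭columnProfiles sG bG (canonical-exactCover c)) (↭-reflexive (cong columnProfiles (columns-canonical c)))))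
  π = proj₁ (↭⇒permutation sameProfiles (profiles s bs) refl)
  toList≡ = proj₂ (↭⇒permutation sameProfiles (profiles s bs) refl)

counitBi-columnsOf : ∀ F → counitBi (columnsOf F) ≡ counitComp F
counitBi-columnsOf (zero  , comp [] []       , _) = refl
counitBi-columnsOf (zero  , comp [] ([] ∷ _) , v) = ⊥-elim v
counitBi-columnsOf (suc n , comp s []        , v) = ⊥-elim v
counitBi-columnsOf (suc n , comp s (_ ∷ _)   , _) = refl

module FormalSums {c ℓ : Level} (K : Field c ℓ) where
  open Field K using (Carrier)
  open FreeMod K

  mapBasis : {B C : Set} → (B → C) → Vect B → Vect C
  mapBasis f = L.map (λ (a , b) → (a , f b))

  ≡⇒Equiv : {B : Set} {R : B → B → Set} {v w : Vect B} → v ≡ w → Equiv R v w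
  ≡⇒Equiv refl = ∼-refl

  mapBasis-cong : {B C : Set} {R : B → B → Set} {S : C → C → Set} (f : B → C) →
    (∀ {a b b′ v} → R b b′ → Equiv S ((a , f b) ∷ v) ((a , f b′) ∷ v)) →
    ∀ {v w} → Equiv R v w → Equiv S (mapBasis f v) (mapBasis f w)
  mapBasis-cong f h ∼-refl          = ∼-refl
  mapBasis-cong f h (∼-sym e)       = ∼-sym (mapBasis-cong f h e)
  mapBasis-cong f h (∼-trans e e′)  = ∼-trans (mapBasis-cong f h e) (mapBasis-cong f h e′)
  mapBasis-cong f h (∼-cons e)      = ∼-cons (mapBasis-cong f h e)
  mapBasis-cong f h ∼-swap          = ∼-swap
  mapBasis-cong f h ∼-zero          = ∼-zero
  mapBasis-cong f h ∼-add           = ∼-add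
  mapBasis-cong f h (∼-coef a≈a′)   = ∼-coef a≈a′
  mapBasis-cong f h (∼-rel r)       = h r

  mapBasis-scale : {B C : Set} (f : B → C) (k : Carrier) (v : Vect B) → mapBasis f (scale k v) ≡ scale k (mapBasis f v)
  mapBasis-scale f k v = trans (sym (Lₚ.map-∘ v)) (Lₚ.map-∘ v)

  mapBasis-basisSum : {B C : Set} (f : B → C) (bs : List B) → mapBasis f (basisSum bs) ≡ basisSum (L.map f bs)
  mapBasis-basisSum f bs = trans (sym (Lₚ.map-∘ bs)) (Lₚ.map-∘ bs)

  ++-cong : {B : Set} {R : B → B → Set} {x x′ y y′ : Vect B} → Equiv R x x′ → Equiv R y y′ → Equiv R (x L.++ y) (x′ L.++ y′)
  ++-cong {x′ = x′} {y = y} e e′ = ∼-trans (congˡ e) (congʳ x′ e′)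
    where
    congˡ : ∀ {x x′} → Equiv _ x x′ → Equiv _ (x L.++ y) (x′ L.++ y)
    congˡ ∼-refl         = ∼-refl
    congˡ (∼-sym e)      = ∼-sym (congˡ e)
    congˡ (∼-trans e e′) = ∼-trans (congˡ e) (congˡ e′)
    congˡ (∼-cons e)     = ∼-cons (congˡ e)
    congˡ ∼-swap         = ∼-swap
    congˡ ∼-zero         = ∼-zero
    congˡ ∼-add          = ∼-add
    congˡ (∼-coef a≈a′)  = ∼-coef a≈a′
    congˡ (∼-rel r)      = ∼-rel r
    congʳ : ∀ x {y y′} → Equiv _ y y′ → Equiv _ (x L.++ y) (x L.++ y′)
    congʳ []      e = e
    congʳ (t ∷ x) e = ∼-cons (congʳ x e)

-- The isomorphism [F] ↦ M_(columns of F)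

module Isomorphism {c ℓ : Level} (K : Field c ℓ) where
  open Field K using (Carrier; _*_; 1#; 0#; reflexive; *-congˡ; *-identityˡ; *-identityʳ)
    renaming (_+_ to _+ᴷ_; sym to ≈-sym; trans to ≈-trans)
  open FreeMod K
  open FormalSums K
  private
    module A = Ops DQΛ
    module B = Ops DQSym

  φ : A.V → B.V
  φ = mapBasis columnsOf

  ψ : B.V → A.V
  ψ = mapBasis canonical

  φ-cong : ∀ {v w} → v A.≋ w → φ v B.≋ φ w
  φ-cong = mapBasis-cong columnsOf (λ r → ≡⇒Equiv (cong (λ z → (_ , z) ∷ _) (columnsOf-orbit r)))

  ψ∘φ : ∀ v → v A.≋ ψ (φ v)
  ψ∘φ []            = ∼-refl
  ψ∘φ ((a , F) ∷ v) = ∼-trans (∼-rel (orbit-canonical F)) (∼-cons (ψ∘φ v))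

  φ∘ψ : ∀ y → φ (ψ y) ≡ y
  φ∘ψ []            = refl
  φ∘ψ ((a , x) ∷ y) = cong₂ _∷_ (cong (a ,_) (columnsOf-canonical x)) (φ∘ψ y)

  φ-injective : ∀ {v w} → φ v B.≋ φ w → v A.≋ w
  φ-injective {v} {w} e = ∼-trans (ψ∘φ v) (∼-trans (mapBasis-cong canonical (λ ()) e) (∼-sym (ψ∘φ w)))

  φ-mul : ∀ v w → φ (A.mul v w) ≡ B.mul (φ v) (φ w)
  φ-mul v w = begin
    φ (concatMap (λ (a , F) → concatMap (λ (b , G) → productA a b F G) w) v)
      ≡⟨ Lₚ.map-concatMap _ _ v ⟩
    concatMap (λ (a , F) → φ (concatMap (λ (b , G) → productA a b F G) w)) v
      ≡⟨ Lₚ.concatMap-cong (λ (a , F) → Lₚ.map-concatMap _ _ w) v ⟩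
    concatMap (λ (a , F) → concatMap (λ (b , G) → φ (productA a b F G)) w) v
      ≡⟨ Lₚ.concatMap-cong (λ (a , F) → Lₚ.concatMap-cong (λ (b , G) → basisProduct a b F G) w) v ⟩
    concatMap (λ (a , F) → concatMap (λ (b , G) → productB a b (columnsOf F) (columnsOf G)) w) v
      ≡⟨ Lₚ.concatMap-cong (λ (a , F) → Lₚ.concatMap-map _ _ w) v ⟨
    concatMap (λ (a , F) → concatMap (λ (b , y) → productB a b (columnsOf F) y) (φ w)) v
      ≡⟨ Lₚ.concatMap-map _ _ v ⟨
    B.mul (φ v) (φ w) ∎
    where
    open ≡-Reasoning
    productA : Carrier → Carrier → Comp → Comp → A.V
    productA a b F G = scale (a * b) (basisSum (prodComp F G))
    productB : Carrier → Carrier → BiComp → BiComp → B.V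
    productB a b x y = scale (a * b) (basisSum (prodBi x y))
    basisProduct : ∀ a b F G → φ (productA a b F G) ≡ productB a b (columnsOf F) (columnsOf G)
    basisProduct a b F G = begin
      φ (scale (a * b) (basisSum (prodComp F G)))            ≡⟨ mapBasis-scale columnsOf (a * b) _ ⟩
      scale (a * b) (φ (basisSum (prodComp F G)))            ≡⟨ cong (scale (a * b)) (mapBasis-basisSum columnsOf (prodComp F G)) ⟩
      scale (a * b) (basisSum (L.map columnsOf (prodComp F G))) ≡⟨ cong (scale (a * b) ∘ basisSum) (columnsOf-prodComp F G) ⟩
      productB a b (columnsOf F) (columnsOf G) ∎

  tensorImage : Carrier × (Comp × Comp) → Vect (BiComp × BiComp)
  tensorImage (a , F , G) = scale a (tensorV (φ [ (1# , F) ]) (φ [ (1# , G) ]))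

  φ-Δ : ∀ v → B.Δ (φ v) B.≋⊗ concatMap tensorImage (A.Δ v)
  φ-Δ []            = ∼-refl
  φ-Δ ((a , F) ∷ v) = ∼-trans
    (++-cong (∼-trans (≡⇒Equiv (cong (scale a ∘ basisSum) (sym (columnsOf-copComp F)))) (perTerm (copComp F))) (φ-Δ v))
    (≡⇒Equiv (sym (Lₚ.concatMap-++ tensorImage (scale a (basisSum (copComp F))) (A.Δ v))))
    where
    -- the coefficient of a term of Δ(φ v) is a·1, that of its image a·1·(1·1)
    perTerm : (Ls : List (Comp × Comp)) → scale a (basisSum (L.map columnsOf² Ls)) B.≋⊗ concatMap tensorImage (scale a (basisSum Ls))
    perTerm []       = ∼-refl
    perTerm (q ∷ Ls) = ∼-trans (∼-coef (≈-sym (≈-trans (*-congˡ (*-identityˡ 1#)) (*-identityʳ _)))) (∼-cons (perTerm Ls))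

  φ-ε : ∀ v → B.ε (φ v) ≡ A.ε v
  φ-ε []            = refl
  φ-ε ((a , F) ∷ v) = cong₂ (λ z w → (a * (if z then 1# else 0#)) +ᴷ w) (counitBi-columnsOf F) (φ-ε v)

  iso : DQΛ ≅Hopf DQSym
  iso = record
    { φ       = φ
    ; φ-cong  = φ-cong
    ; φ-add   = λ v w → ≡⇒Equiv (Lₚ.map-++ _ v w)
    ; φ-scale = λ a v → ≡⇒Equiv (mapBasis-scale columnsOf a v)
    ; φ-inj   = φ-injective
    ; φ-surj  = λ y → ψ y , ≡⇒Equiv (φ∘ψ y)
    ; φ-one   = ∼-refl
    ; φ-mul   = λ v w → ≡⇒Equiv (φ-mul v w)
    ; φ-Δ     = φ-Δ
    ; φ-ε     = λ v → reflexive (φ-ε v)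
    }

mainTheorem8 : ∀ {c ℓ : Level} (K : Field c ℓ) → FreeMod._≅Hopf_ K DQΛ DQSym
mainTheorem8 K = Isomorphism.iso K
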